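{- Let $n,k,j$ be integers with $k\ge1$ and $2\le j\le \frac{n-k}{2}$, and let $H_k$ be any graph on $k$ vertices. For $1\le i\le n-k-1$ let $G(i,n-k-i)$ denote the graph on $n$ vertices obtained from disjoint copies of $K_i$, $H_k$ and $K_{n-k-i}$ by joining every vertex of $H_k$ to every vertex of $K_i$ and of $K_{n-k-i}$ (with no edges between $K_i$ and $K_{n-k-i}$). Then $\prod_1(G(j,n-k-j))<\prod_1(G(1,n-k-1))$.
   Context: $\prod_1(G)=\prod_{u\in V(G)} d(u)^2$, where $d(u)$ is the degree of $u$. The same graph $H_k$ is used in both $G(j,n-k-j)$ and $G(1,n-k-1)$. -}

module Defs where

open import Data.Nat using (ℕ; zero; suc; _+_; _*_; _∸_)
open import Data.Bool using (Bool; true; false; not; _∧_; _∨_; if_then_else_)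
open import Data.Fin using (Fin; splitAt; _≟_)
open import Data.Sum using (_⊎_; inj₁; inj₂)
open import Data.List using (List; length; filter; map)
open import Data.Nat.ListAction using (product)
open import Relation.Binary.PropositionalEquality using (refl)
import Data.Empty
import Relation.Nullary
import Data.Bool
open import Data.List.Base using (allFin)
open import Relation.Binary.PropositionalEquality using (_≡_)
open import Relation.Nullary.Decidable using (⌊_⌋)

record Graph (v : ℕ) : Set where
  field
    adj   : Fin v → Fin v → Bool
    sym   : ∀ x y → adj x y ≡ adj y x
    irrefl : ∀ x → adj x x ≡ false
open Graph public

degree : ∀ {v} → Graph v → Fin v → ℕ
degree {v} G x = length (filter (λ y → Data.Bool.T? (adj G x y)) (allFin v))

Π₁ : ∀ {v} → Graph v → ℕ
Π₁ {v} G = product (map (λ u → degree G u * degree G u) (allFin v))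

-- The three parts of the vertex set Fin (i + (k + m)):
-- the clique K_i, the graph H_k, and the clique K_m.
data Part (i k m : ℕ) : Set where
  inA : Fin i → Part i k m
  inH : Fin k → Part i k m
  inB : Fin m → Part i k m

part : ∀ i k m → Fin (i + (k + m)) → Part i k m
part i k m x with splitAt i x
... | inj₁ a = inA a
... | inj₂ y with splitAt k y
...   | inj₁ h = inH h
...   | inj₂ b = inB b

joinAdj : ∀ {i k m} → Graph k → Part i k m → Part i k m → Bool
joinAdj H (inA a) (inA a') = not ⌊ a ≟ a' ⌋
joinAdj H (inA _) (inH _)  = true
joinAdj H (inA _) (inB _)  = false
joinAdj H (inH _) (inA _)  = true
joinAdj H (inH h) (inH h') = adj H h h'
joinAdj H (inH _) (inB _)  = true
joinAdj H (inB _) (inA _)  = false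
joinAdj H (inB _) (inH _)  = true
joinAdj H (inB b) (inB b') = not ⌊ b ≟ b' ⌋

Gadj : ∀ i {k} m → Graph k → Fin (i + (k + m)) → Fin (i + (k + m)) → Bool
Gadj i {k} m H x y = joinAdj H (part i k m x) (part i k m y)

joinSym : ∀ {i k m} (H : Graph k) (p q : Part i k m) → joinAdj H p q ≡ joinAdj H q p
joinSym H (inA a) (inA a') with a ≟ a' | a' ≟ a
... | Relation.Nullary.yes _ | Relation.Nullary.yes _ = refl
... | Relation.Nullary.no _  | Relation.Nullary.no _  = refl
... | Relation.Nullary.yes e | Relation.Nullary.no n = Data.Empty.⊥-elim (n (Relation.Binary.PropositionalEquality.sym e))
... | Relation.Nullary.no n  | Relation.Nullary.yes e = Data.Empty.⊥-elim (n (Relation.Binary.PropositionalEquality.sym e))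
joinSym H (inA _) (inH _) = refl
joinSym H (inA _) (inB _) = refl
joinSym H (inH _) (inA _) = refl
joinSym H (inH h) (inH h') = sym H h h'
joinSym H (inH _) (inB _) = refl
joinSym H (inB _) (inA _) = refl
joinSym H (inB _) (inH _) = refl
joinSym H (inB b) (inB b') with b ≟ b' | b' ≟ b
... | Relation.Nullary.yes _ | Relation.Nullary.yes _ = refl
... | Relation.Nullary.no _  | Relation.Nullary.no _  = refl
... | Relation.Nullary.yes e | Relation.Nullary.no n = Data.Empty.⊥-elim (n (Relation.Binary.PropositionalEquality.sym e))
... | Relation.Nullary.no n  | Relation.Nullary.yes e = Data.Empty.⊥-elim (n (Relation.Binary.PropositionalEquality.sym e))

joinIrr : ∀ {i k m} (H : Graph k) (p : Part i k m) → joinAdj H p p ≡ false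
joinIrr H (inA a) with a ≟ a
... | Relation.Nullary.yes _ = refl
... | Relation.Nullary.no n = Data.Empty.⊥-elim (n refl)
joinIrr H (inH h) = irrefl H h
joinIrr H (inB b) with b ≟ b
... | Relation.Nullary.yes _ = refl
... | Relation.Nullary.no n = Data.Empty.⊥-elim (n refl)

Gjoin : ∀ i {k} m → Graph k → Graph (i + (k + m))
Gjoin i {k} m H = record
  { adj = Gadj i m H
  ; sym = λ x y → joinSym H (part i k m x) (part i k m y)
  ; irrefl = λ x → joinIrr H (part i k m x)
  }

module Submission where

-- Write k = a + 1.  In G(i, m) a vertex of K_i has degree a + i, a vertex of
-- K_m has degree a + m and a vertex h of H_k has degree i + m + d_H(h), so
--   Π₁(G(i, m)) = hub(i + m) · (P(i) · P(m))²,  with  P(x) = (a + x)^x,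
-- where hub(N) = ∏_h (N + d_H(h))² only depends on i + m.  The theorem thus
-- reduces to P(j) · P(N - j) < P(1) · P(N - 1) for 2 ≤ j ≤ N - j.

open import Defs hiding (sym)
open import Data.Nat hiding (_≟_)
open import Data.Nat.Properties hiding (_≟_)
open import Data.Nat.Tactic.RingSolver using (solve-∀)
open import Data.Sum using (inj₁; inj₂)
open import Data.Bool using (Bool; true; false; not; if_then_else_; T?)
open import Data.Fin using (Fin; zero; suc; _↑ˡ_; _↑ʳ_; _≟_)
open import Data.List using (length; filter; map; tabulate)
open import Data.Nat.ListAction using (product)
open import Relation.Nullary.Decidable using (⌊_⌋; yes; no)
open import Data.Fin.Properties using (splitAt-↑ˡ; splitAt-↑ʳ)
open import Function using (_∘_; id)
open import Relation.Binary.PropositionalEquality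
  using (_≡_; refl; sym; trans; cong; cong₂; subst; subst₂; module ≡-Reasoning)

*-^-distrib : ∀ m n x → (m * n) ^ x ≡ m ^ x * n ^ x
*-^-distrib m n zero    = refl
*-^-distrib m n (suc x) = trans (cong (m * n *_) (*-^-distrib m n x)) (swap m n (m ^ x) (n ^ x))
  where
    swap : ∀ m n p q → m * n * (p * q) ≡ m * p * (n * q)
    swap = solve-∀

power-gap : ∀ D x → suc D ^ suc x ≤ suc D * D ^ x + x * suc D ^ x
power-gap D zero    = ≤-reflexive (sym (+-identityʳ _))
power-gap D (suc x) = begin
    suc D * suc D ^ suc x
  ≤⟨ *-monoʳ-≤ (suc D) (power-gap D x) ⟩
    suc D * (suc D * D ^ x + x * suc D ^ x)
  ≡⟨ expand D (D ^ x) (suc D ^ x) x ⟩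
    suc D * D * D ^ x + suc D * D ^ x + x * (suc D * suc D ^ x)
  ≤⟨ +-monoˡ-≤ _ (+-monoʳ-≤ (suc D * D * D ^ x) (*-monoʳ-≤ (suc D) (^-monoˡ-≤ x (n≤1+n D)))) ⟩
    suc D * D * D ^ x + suc D * suc D ^ x + x * (suc D * suc D ^ x)
  ≡⟨ collect D (D ^ x) (suc D ^ x) x ⟩
    suc D * (D * D ^ x) + suc x * (suc D * suc D ^ x)
  ∎
  where
    open ≤-Reasoning
    expand : ∀ D p q x → suc D * (suc D * p + x * q) ≡ suc D * D * p + suc D * p + x * (suc D * q)
    expand = solve-∀
    collect : ∀ D p q x → suc D * D * p + suc D * q + x * (suc D * q) ≡ suc D * (D * p) + suc x * (suc D * q)
    collect = solve-∀

-- The polynomial inequality behind log-convexity, with c = (d+1)², q = (d+2)²: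
-- c² + d·q < c·q, as c·q - c² - d·q = d³ + 3d² + 4d + 3.
square-gap : ∀ d → suc d * suc d * (suc d * suc d) + d * ((2 + d) * (2 + d))
                   < suc d * suc d * ((2 + d) * (2 + d))
square-gap d = subst (lhs <_) (difference d) (m<m+n lhs (s≤s z≤n))
  where
    lhs : ℕ
    lhs = suc d * suc d * (suc d * suc d) + d * ((2 + d) * (2 + d))
    difference : ∀ d → suc d * suc d * (suc d * suc d) + d * ((2 + d) * (2 + d)) + suc (d * d * d + 3 * d * d + 4 * d + 2)
                     ≡ suc d * suc d * ((2 + d) * (2 + d))
    difference = solve-∀

-- With c = (d+1)² = D + 1, D = d(d+2), q = (d+2)² this reads c^(x+1) < D^x q;
-- multiplied by c it follows from power-gap (times q) and square-gap.
power-log-convex : ∀ d x → x ≤ d → suc d ^ suc x * suc d ^ suc x < d ^ x * (2 + d) ^ (2 + x)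
power-log-convex d x x≤d = subst₂ _<_ (sym lhs) (sym rhs) (*-cancelˡ-< c _ _ times-c)
  where
    c D q cˣ Dˣ : ℕ
    c = suc d * suc d
    D = d * (2 + d)
    q = (2 + d) * (2 + d)
    cˣ = c ^ x
    Dˣ = D ^ x
    c≡1+D : c ≡ suc D
    c≡1+D = square-succ d
      where
        square-succ : ∀ d → suc d * suc d ≡ suc (d * (2 + d))
        square-succ = solve-∀
    gap : c * cˣ ≤ c * Dˣ + x * cˣ
    gap = subst (λ z → z * z ^ x ≤ z * Dˣ + x * z ^ x) (sym c≡1+D) (power-gap D x)
    instance
      cˣ-nonZero : NonZero cˣ
      cˣ-nonZero = m^n≢0 c x
    times-c : c * (c * cˣ) < c * (Dˣ * q)
    times-c = +-cancelʳ-< (x * cˣ * q) _ _ (begin-strict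
        c * (c * cˣ) + x * cˣ * q
      ≤⟨ +-monoʳ-≤ (c * (c * cˣ)) (*-monoˡ-≤ q (*-monoˡ-≤ cˣ x≤d)) ⟩
        c * (c * cˣ) + d * cˣ * q
      ≡⟨ factor-l c d q cˣ ⟩
        (c * c + d * q) * cˣ
      <⟨ *-monoˡ-< cˣ (square-gap d) ⟩
        c * q * cˣ
      ≡⟨ factor-r c q cˣ ⟩
        c * cˣ * q
      ≤⟨ *-monoˡ-≤ q gap ⟩
        (c * Dˣ + x * cˣ) * q
      ≡⟨ factor-m c Dˣ q x cˣ ⟩
        c * (Dˣ * q) + x * cˣ * q
      ∎)
      where
        open ≤-Reasoning
        factor-l : ∀ c d q p → c * (c * p) + d * p * q ≡ (c * c + d * q) * p
        factor-l = solve-∀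
        factor-r : ∀ c q p → c * q * p ≡ c * p * q
        factor-r = solve-∀
        factor-m : ∀ c r q x p → (c * r + x * p) * q ≡ c * (r * q) + x * p * q
        factor-m = solve-∀
    lhs : suc d ^ suc x * suc d ^ suc x ≡ c * cˣ
    lhs = sym (*-^-distrib (suc d) (suc d) (suc x))
    rhs : d ^ x * (2 + d) ^ (2 + x) ≡ Dˣ * q
    rhs = trans (regroup (d ^ x) ((2 + d) ^ x) (2 + d)) (cong (_* q) (sym (*-^-distrib d (2 + d) x)))
      where
        regroup : ∀ p r t → p * (t * (t * r)) ≡ p * r * (t * t)
        regroup = solve-∀

StrictlyLogConvex : (ℕ → ℕ) → Set
StrictlyLogConvex f = ∀ x → f (suc x) * f (suc x) < f x * f (2 + x)

cross-compose : ∀ a b c d e s → a * d < b * c → c * s < d * e → a * s < b * e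
cross-compose a b c d e s ad<bc cs<de =
  *-cancelˡ-< (c * d) _ _ (subst₂ _<_ (regroupˡ a d c s) (regroupʳ b c d e) (*-mono-< ad<bc cs<de))
  where
    regroupˡ : ∀ a d c s → a * d * (c * s) ≡ c * d * (a * s)
    regroupˡ = solve-∀
    regroupʳ : ∀ b c d e → b * c * (d * e) ≡ c * d * (b * e)
    regroupʳ = solve-∀

module LogConvex {f : ℕ → ℕ} (convex : StrictlyLogConvex f) where

  exchange : ∀ {x y} → x < y → f (suc x) * f y < f x * f (suc y)
  exchange {x} {suc y} x<1+y with m<1+n⇒m<n∨m≡n x<1+y
  ... | inj₁ x<y  = cross-compose (f (suc x)) (f x) (f (suc y)) (f y) (f (2 + y)) (f (suc y))
                        (exchange x<y) (convex y)
  ... | inj₂ refl = convex x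

  -- Replacing an ordered pair of indices (b + s + 1, y) by the pair
  -- (b, s + 1 + y), which has the same sum but is farther apart, increases
  -- the product: f(b + s + 1) · f(y) < f(b) · f(s + 1 + y) when b + s < y.
  spread : ∀ s {b y} → b + s < y → f (b + suc s) * f y < f b * f (suc s + y)
  spread zero {b} b+0<y rewrite +-identityʳ b | +-comm b 1 = exchange b+0<y
  spread (suc s) {b} {y} b+1+s<y rewrite +-suc b (suc s) | sym (+-suc s y) =
    <-trans (exchange b+1+s<y) (spread s (s≤s (≤-trans (+-monoʳ-≤ b (n≤1+n s)) (<⇒≤ b+1+s<y))))

-- P a x = (a + x)^x; with k = a + 1 this is the contribution of a clique K_x
-- joined to H_k, each of its x vertices having degree a + x.
clique-power : ℕ → ℕ → ℕ
clique-power a x = (a + x) ^ x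

clique-power-log-convex : ∀ a → StrictlyLogConvex (clique-power a)
clique-power-log-convex a x rewrite +-suc a (suc x) | +-suc a x =
  power-log-convex (a + x) x (m≤n+m x a)

-- Counting and multiplying over Fin v by recursion on v; unlike the list
-- operations used in Defs, these split along Fin (i + r) = Fin i ⊎ Fin r.
count : ∀ {v} → (Fin v → Bool) → ℕ
count {zero}  p = 0
count {suc v} p = (if p zero then 1 else 0) + count (p ∘ suc)

prod : ∀ {v} → (Fin v → ℕ) → ℕ
prod {zero}  f = 1
prod {suc v} f = f zero * prod (f ∘ suc)

length-filter-tabulate : ∀ {B : Set} (p : B → Bool) {v} (g : Fin v → B) →
  length (filter (T? ∘ p) (tabulate g)) ≡ count (p ∘ g)
length-filter-tabulate p {zero}  g = refl
length-filter-tabulate p {suc v} g with p (g zero)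
... | true  = cong suc (length-filter-tabulate p (g ∘ suc))
... | false = length-filter-tabulate p (g ∘ suc)

product-map-tabulate : ∀ {B : Set} (h : B → ℕ) {v} (g : Fin v → B) →
  product (map h (tabulate g)) ≡ prod (h ∘ g)
product-map-tabulate h {zero}  g = refl
product-map-tabulate h {suc v} g = cong (h (g zero) *_) (product-map-tabulate h (g ∘ suc))

count-cong : ∀ {v} {p q : Fin v → Bool} → (∀ x → p x ≡ q x) → count p ≡ count q
count-cong {zero}  eq = refl
count-cong {suc v} eq = cong₂ (λ b n → (if b then 1 else 0) + n) (eq zero) (count-cong (eq ∘ suc))

prod-cong : ∀ {v} {f g : Fin v → ℕ} → (∀ x → f x ≡ g x) → prod f ≡ prod g
prod-cong {zero}  eq = refl
prod-cong {suc v} eq = cong₂ _*_ (eq zero) (prod-cong (eq ∘ suc))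

count-++ : ∀ i {r} (p : Fin (i + r) → Bool) →
  count p ≡ count (λ x → p (x ↑ˡ r)) + count (λ y → p (i ↑ʳ y))
count-++ zero    p = refl
count-++ (suc i) p = trans (cong ((if p zero then 1 else 0) +_) (count-++ i (p ∘ suc)))
  (sym (+-assoc (if p zero then 1 else 0) _ _))

prod-++ : ∀ i {r} (f : Fin (i + r) → ℕ) →
  prod f ≡ prod (λ x → f (x ↑ˡ r)) * prod (λ y → f (i ↑ʳ y))
prod-++ zero    f = sym (+-identityʳ _)
prod-++ (suc i) f = trans (cong (f zero *_) (prod-++ i (f ∘ suc))) (sym (*-assoc (f zero) _ _))

count-true : ∀ v → count {v} (λ _ → true) ≡ v
count-true zero    = refl
count-true (suc v) = cong suc (count-true v)

count-false : ∀ v → count {v} (λ _ → false) ≡ 0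
count-false zero    = refl
count-false (suc v) = count-false v

-- Equality tests commute with suc; this does not hold by computation since
-- suc x ≟ suc y is defined through Relation.Nullary.Decidable.map′.
≟-suc : ∀ {n} (x y : Fin n) → ⌊ suc x ≟ suc y ⌋ ≡ ⌊ x ≟ y ⌋
≟-suc x y with x ≟ y
... | yes _ = refl
... | no _  = refl

count-others : ∀ {i} (x : Fin i) → suc (count (λ y → not ⌊ x ≟ y ⌋)) ≡ i
count-others {suc i} zero    = cong suc (count-true i)
count-others {suc i} (suc x) =
  cong suc (trans (cong suc (count-cong (λ y → cong not (≟-suc x y)))) (count-others x))

prod-const : ∀ v c → prod {v} (λ _ → c) ≡ c ^ v
prod-const zero    c = refl
prod-const (suc v) c = cong (c *_) (prod-const v c)

prod-pos : ∀ {v} (f : Fin v → ℕ) → (∀ x → 0 < f x) → 0 < prod f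
prod-pos {zero}  f pos = s≤s z≤n
prod-pos {suc v} f pos = *-mono-< (pos zero) (prod-pos (f ∘ suc) (pos ∘ suc))

part-inA : ∀ i k m (x : Fin i) → part i k m (x ↑ˡ (k + m)) ≡ inA x
part-inA i k m x rewrite splitAt-↑ˡ i x (k + m) = refl

part-inH : ∀ i k m (h : Fin k) → part i k m (i ↑ʳ (h ↑ˡ m)) ≡ inH h
part-inH i k m h rewrite splitAt-↑ʳ i (k + m) (h ↑ˡ m) | splitAt-↑ˡ k h m = refl

part-inB : ∀ i k m (y : Fin m) → part i k m (i ↑ʳ (k ↑ʳ y)) ≡ inB y
part-inB i k m y rewrite splitAt-↑ʳ i (k + m) (k ↑ʳ y) | splitAt-↑ʳ k m y = refl

count-parts : ∀ i k m (p : Part i k m → Bool) →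
  count (p ∘ part i k m) ≡ count (p ∘ inA) + (count (p ∘ inH) + count (p ∘ inB))
count-parts i k m p = trans (count-++ i _) (cong₂ _+_
  (count-cong (λ x → cong p (part-inA i k m x)))
  (trans (count-++ k _) (cong₂ _+_
    (count-cong (λ h → cong p (part-inH i k m h)))
    (count-cong (λ y → cong p (part-inB i k m y))))))

prod-parts : ∀ i k m (f : Part i k m → ℕ) →
  prod (f ∘ part i k m) ≡ prod (f ∘ inA) * (prod (f ∘ inH) * prod (f ∘ inB))
prod-parts i k m f = trans (prod-++ i _) (cong₂ _*_
  (prod-cong (λ x → cong f (part-inA i k m x)))
  (trans (prod-++ k _) (cong₂ _*_
    (prod-cong (λ h → cong f (part-inH i k m h)))
    (prod-cong (λ y → cong f (part-inB i k m y))))))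

part-degree : ∀ {i k m} → Graph k → Part i k m → ℕ
part-degree H p = count (λ x → joinAdj H p (inA x))
                + (count (λ h → joinAdj H p (inH h)) + count (λ y → joinAdj H p (inB y)))

degree-Gjoin : ∀ i {k} m (H : Graph k) x → degree (Gjoin i m H) x ≡ part-degree H (part i k m x)
degree-Gjoin i {k} m H x = trans (length-filter-tabulate (Gadj i m H x) id)
  (count-parts i k m (joinAdj H (part i k m x)))

degree-inA : ∀ a {i m} (H : Graph (suc a)) (x : Fin i) → part-degree {m = m} H (inA x) ≡ a + i
degree-inA a {i} {m} H x = begin
    c + (count {suc a} (λ _ → true) + count {m} (λ _ → false))
  ≡⟨ cong₂ (λ u w → c + (u + w)) (count-true (suc a)) (count-false m) ⟩
    c + (suc a + 0)
  ≡⟨ regroup c a ⟩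
    a + suc c
  ≡⟨ cong (a +_) (count-others x) ⟩
    a + i
  ∎
  where
    open ≡-Reasoning
    c : ℕ
    c = count (λ y → not ⌊ x ≟ y ⌋)
    regroup : ∀ c a → c + (suc a + 0) ≡ a + suc c
    regroup = solve-∀

degree-inB : ∀ a {i m} (H : Graph (suc a)) (y : Fin m) → part-degree {i = i} H (inB y) ≡ a + m
degree-inB a {i} {m} H y = begin
    count {i} (λ _ → false) + (count {suc a} (λ _ → true) + c)
  ≡⟨ cong₂ (λ u w → u + (w + c)) (count-false i) (count-true (suc a)) ⟩
    suc a + c
  ≡⟨ +-suc a c ⟨
    a + suc c
  ≡⟨ cong (a +_) (count-others y) ⟩
    a + m
  ∎
  where
    open ≡-Reasoning
    c : ℕ
    c = count (λ z → not ⌊ y ≟ z ⌋)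

degree-inH : ∀ {i k m} (H : Graph k) (h : Fin k) → part-degree {i} {k} {m} H (inH h) ≡ i + m + count (adj H h)
degree-inH {i} {k} {m} H h =
  trans (cong₂ (λ u w → u + (count (adj H h) + w)) (count-true i) (count-true m)) (regroup i (count (adj H h)) m)
  where
    regroup : ∀ i d m → i + (d + m) ≡ i + m + d
    regroup = solve-∀

square : ℕ → ℕ
square x = x * x

hub : ∀ {k} → Graph k → ℕ → ℕ
hub H N = prod (λ h → square (N + count (adj H h)))

hub-pos : ∀ {k} (H : Graph k) N → 0 < hub H (suc N)
hub-pos H N = prod-pos (λ h → square (suc N + count (adj H h))) (λ h → s≤s z≤n)

clique-factor : ∀ a {i} (d : Fin i → ℕ) → (∀ x → d x ≡ a + i) →
  prod (square ∘ d) ≡ square (clique-power a i)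
clique-factor a {i} d deg = begin
    prod (square ∘ d)
  ≡⟨ prod-cong (λ x → cong square (deg x)) ⟩
    prod {i} (λ _ → square (a + i))
  ≡⟨ prod-const i (square (a + i)) ⟩
    square (a + i) ^ i
  ≡⟨ *-^-distrib (a + i) (a + i) i ⟩
    square (clique-power a i)
  ∎
  where open ≡-Reasoning

Π₁-Gjoin : ∀ a i m (H : Graph (suc a)) →
  Π₁ (Gjoin i m H) ≡ hub H (i + m) * square (clique-power a i * clique-power a m)
Π₁-Gjoin a i m H = begin
    Π₁ (Gjoin i m H)
  ≡⟨ product-map-tabulate (square ∘ degree (Gjoin i m H)) id ⟩
    prod (square ∘ degree (Gjoin i m H))
  ≡⟨ prod-cong (λ x → cong square (degree-Gjoin i m H x)) ⟩
    prod (square ∘ deg ∘ part i (suc a) m)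
  ≡⟨ prod-parts i (suc a) m (square ∘ deg) ⟩
    prod (square ∘ deg ∘ inA) * (prod (square ∘ deg ∘ inH) * prod (square ∘ deg ∘ inB))
  ≡⟨ cong₂ _*_ (clique-factor a _ (degree-inA a {i} {m} H))
       (cong₂ _*_ (prod-cong (λ h → cong square (degree-inH {i} {m = m} H h)))
                  (clique-factor a _ (degree-inB a {i} {m} H))) ⟩
    square (clique-power a i) * (hub H (i + m) * square (clique-power a m))
  ≡⟨ regroup (clique-power a i) (hub H (i + m)) (clique-power a m) ⟩
    hub H (i + m) * square (clique-power a i * clique-power a m)
  ∎
  where
    open ≡-Reasoning
    deg : Part i (suc a) m → ℕ
    deg = part-degree H
    regroup : ∀ p w q → p * p * (w * (q * q)) ≡ w * (p * q * (p * q))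
    regroup = solve-∀

-- Lemma 3.3.  With k = a + 1, N = n - k, j = t + 2 and m = N - j, both graphs
-- have the same hub factor hub(N), while j ≤ m lets spread (for the
-- log-convex P) give P(j) · P(m) < P(1) · P(t + 1 + m) = P(1) · P(N - 1).
lemma3p3 : (n k j : ℕ) → 1 ≤ k → 2 ≤ j → 2 * j ≤ n ∸ k →
    (H : Graph k) →
    Π₁ (Gjoin j (n ∸ k ∸ j) H) < Π₁ (Gjoin 1 (n ∸ k ∸ 1) H)
lemma3p3 n (suc a) (suc (suc t)) _ (s≤s (s≤s z≤n)) 2j≤N H =
  subst (λ z → Π₁ (Gjoin j m H) < Π₁ (Gjoin 1 z H)) (sym N∸1≡1+t+m) (begin-strict
    Π₁ (Gjoin j m H)
  ≡⟨ Π₁-Gjoin a j m H ⟩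
    hub H (j + m) * square (P j * P m)
  <⟨ *-monoʳ-< (hub H (j + m)) {{>-nonZero (hub-pos H (suc (t + m)))}} (*-mono-< exchange exchange) ⟩
    hub H (j + m) * square (P 1 * P (suc t + m))
  ≡⟨ Π₁-Gjoin a 1 (suc t + m) H ⟨
    Π₁ (Gjoin 1 (suc t + m) H)
  ∎)
  where
    open ≤-Reasoning
    P : ℕ → ℕ
    P = clique-power a
    j N m : ℕ
    j = suc (suc t)
    N = n ∸ suc a
    m = N ∸ j
    j≤N : j ≤ N
    j≤N = ≤-trans (m≤m+n j (j + 0)) 2j≤N
    j≤m : j ≤ m
    j≤m = subst (_≤ m) (trans (m+n∸m≡n j (j + 0)) (+-identityʳ j)) (∸-monoˡ-≤ j 2j≤N)
    N∸1≡1+t+m : N ∸ 1 ≡ suc t + m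
    N∸1≡1+t+m = cong (_∸ 1) (sym (m+[n∸m]≡n j≤N))
    exchange : P j * P m < P 1 * P (suc t + m)
    exchange = LogConvex.spread {P} (clique-power-log-convex a) t j≤m
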